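{- Let $k\geqslant 2$ be an integer and let $\nu(k)$ be the $2$-adic valuation of $k$. Let $m,n$ be positive integers and $x$ a positive integer such that $x\equiv 2^{2m-1}-1\pmod{2^{2m}}$ and $3^{k-1}x\equiv 2^{2n}-1\pmod{2^{2n+1}}$. Let $y$ be the least positive integer satisfying $k2^{ -\nu(k)}\,y\equiv x\pmod{2^{2m+2n+1}}$. Then for every sufficiently large integer $N$, \[ t\left((y2^{kN-\nu(k)}+2^N+1)^k\right)\neq t\left((y2^{kN-\nu(k)+1}+2^N+1)^k\right) \] and \[ t\left((y2^{kN-\nu(k)}+2^N+3)^k\right)= t\left((y2^{kN-\nu(k)+1}+2^N+3)^k\right). \]
   Context: For an integer $n\geqslant 0$, let $s_2(n)$ be the number of ones in the binary expansion of $n$; the Thue--Morse sequence is $t(n)=1$ if $s_2(n)$ is odd and $t(n)=0$ if $s_2(n)$ is even. -}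

module Defs where

open import Data.Nat using (ℕ; zero; suc; _+_; _*_; _^_; _%_; _/_)
open import Data.Nat using (NonZero)
open import Data.Nat.Properties using (m^n≢0)

mod2^ : ℕ → ℕ → ℕ
mod2^ a j = _%_ a (2 ^ j) {{m^n≢0 2 j}}

div2^ : ℕ → ℕ → ℕ
div2^ a j = _/_ a (2 ^ j) {{m^n≢0 2 j}}

-- number of ones in the binary expansion, computed with fuel (fuel n suffices for n)
s₂-aux : ℕ → ℕ → ℕ
s₂-aux zero n = zero
s₂-aux (suc f) zero = zero
s₂-aux (suc f) n@(suc _) = n % 2 + s₂-aux f (n / 2)

s₂ : ℕ → ℕ
s₂ n = s₂-aux n n

t : ℕ → ℕ
t n = s₂ n % 2

-- 2-adic valuation of a positive integer (with fuel; ν 0 = 0 by convention, unused)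
ν-aux : ℕ → ℕ → ℕ
ν-aux zero n = zero
ν-aux (suc f) zero = zero
ν-aux (suc f) n@(suc _) with n % 2
... | zero = suc (ν-aux f (n / 2))
... | suc _ = zero

ν : ℕ → ℕ
ν n = ν-aux n n

oddPart : ℕ → ℕ
oddPart k = div2^ k (ν k)

module Submission where

-- With a = 2^N + c, P = 2^(kN - ν(k)) and o = k 2^(-ν(k)), the binomial theorem splits
-- (bP + a)^k, for b ∈ {y, 2y} and N large, into non-overlapping binary blocks: the low part
-- of a^k, then 1 + w with w = o b c^(k-1), then o b E where a^(k-1) = c^(k-1) + 2^N E, and
-- finally the digits C(k,i) b^i a^(k-i) (i ≥ 2) in base P.  Passing from y to 2y multiplies
-- every block except 1 + w by a power of two, so s₂ changes exactly by s₂(1 + 2w) - s₂(1 + w),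
-- which is r when w ends in exactly r binary ones.  The congruences on x give r = 2m - 1 for
-- c = 1 and r = 2n for c = 3.

open import Defs
open import Data.Nat using (ℕ; zero; suc; _+_; _*_; _∸_; _^_; _%_; _≤_; _<_)
open import Data.Product using (∃-syntax; _×_)
open import Relation.Binary.PropositionalEquality using (_≡_; _≢_)
open import Data.Nat using (_/_; _≤?_; z≤n; s≤s; NonZero; pred)
open import Data.Nat.Properties
open import Data.Nat.DivMod
open import Data.Nat.Divisibility using (_∣_; divides; n∣m*n; 1∣_; *-monoʳ-∣)
open import Data.Nat.Combinatorics using (_C_; nCn≡1; nC1≡n; nCk+nC[k+1]≡[n+1]C[k+1]; k>n⇒nCk≡0)
open import Data.Nat.Tactic.RingSolver using (solve-∀)
open import Data.Fin using (Fin; toℕ) renaming (zero to fzero; suc to fsuc)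
open import Data.Product using (_,_)
open import Relation.Binary.PropositionalEquality using (refl; sym; trans; cong; cong₂; subst; module ≡-Reasoning)
open import Relation.Nullary using (yes; no)
open import Algebra.Bundles using (CommutativeSemiring)
import Algebra.Definitions.RawMonoid as RawMonoid
import Algebra.Definitions.RawSemiring as RawSemiring
import Algebra.Properties.CommutativeSemiring.Binomial as Binomial

s₂-aux-stable : ∀ {f g} n → n ≤ f → n ≤ g → s₂-aux f n ≡ s₂-aux g n
s₂-aux-stable {zero}  {zero}  zero _ _ = refl
s₂-aux-stable {zero}  {suc _} zero _ _ = refl
s₂-aux-stable {suc _} {zero}  zero _ _ = refl
s₂-aux-stable {suc _} {suc _} zero _ _ = refl
s₂-aux-stable {suc f} {suc g} n@(suc _) (s≤s n∸1≤f) (s≤s n∸1≤g) =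
  cong (n % 2 +_) (s₂-aux-stable (n / 2) (≤-trans n/2≤n∸1 n∸1≤f) (≤-trans n/2≤n∸1 n∸1≤g))
  where
  n/2≤n∸1 : n / 2 ≤ pred n
  n/2≤n∸1 = ≤-pred (m/n<m n 2 (s≤s (s≤s z≤n)))

s₂-unfold : ∀ n → s₂ n ≡ n % 2 + s₂ (n / 2)
s₂-unfold zero       = refl
s₂-unfold n@(suc _)  = cong (n % 2 +_) (s₂-aux-stable (n / 2) (≤-pred (m/n<m n 2 (s≤s (s≤s z≤n)))) ≤-refl)

s₂[b+q*2]≡b+s₂[q] : ∀ {b} q → b < 2 → s₂ (b + q * 2) ≡ b + s₂ q
s₂[b+q*2]≡b+s₂[q] {b} q b<2 = begin
  s₂ (b + q * 2)                          ≡⟨ s₂-unfold (b + q * 2) ⟩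
  (b + q * 2) % 2 + s₂ ((b + q * 2) / 2)  ≡⟨ cong₂ (λ r d → r + s₂ d) low high ⟩
  b + s₂ q                                ∎
  where
  open ≡-Reasoning
  low : (b + q * 2) % 2 ≡ b
  low = trans ([m+kn]%n≡m%n b q 2) (m<n⇒m%n≡m b<2)
  high : (b + q * 2) / 2 ≡ q
  high = trans (+-distrib-/-∣ʳ b (n∣m*n q)) (cong₂ _+_ (m<n⇒m/n≡0 b<2) (m*n/n≡m q 2))

s₂[u+2^L*v]≡s₂[u]+s₂[v] : ∀ L {u} v → u < 2 ^ L → s₂ (u + 2 ^ L * v) ≡ s₂ u + s₂ v
s₂[u+2^L*v]≡s₂[u]+s₂[v] zero    {zero}  v _ = cong s₂ (+-identityʳ v)
s₂[u+2^L*v]≡s₂[u]+s₂[v] zero    {suc _} v (s≤s ())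
s₂[u+2^L*v]≡s₂[u]+s₂[v] (suc L) {u}     v u<2^[1+L] = begin
  s₂ (u + 2 ^ suc L * v)                  ≡⟨ cong s₂ shift-lowest-bit ⟩
  s₂ (u % 2 + (u / 2 + 2 ^ L * v) * 2)    ≡⟨ s₂[b+q*2]≡b+s₂[q] (u / 2 + 2 ^ L * v) (m%n<n u 2) ⟩
  u % 2 + s₂ (u / 2 + 2 ^ L * v)          ≡⟨ cong (u % 2 +_) (s₂[u+2^L*v]≡s₂[u]+s₂[v] L v u/2<2^L) ⟩
  u % 2 + (s₂ (u / 2) + s₂ v)             ≡⟨ +-assoc (u % 2) _ _ ⟨
  u % 2 + s₂ (u / 2) + s₂ v               ≡⟨ cong (_+ s₂ v) (s₂-unfold u) ⟨
  s₂ u + s₂ v                             ∎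
  where
  open ≡-Reasoning
  regroup : ∀ r d p v → r + d * 2 + 2 * p * v ≡ r + (d + p * v) * 2
  regroup = solve-∀
  shift-lowest-bit : u + 2 ^ suc L * v ≡ u % 2 + (u / 2 + 2 ^ L * v) * 2
  shift-lowest-bit = trans (cong (_+ 2 ^ suc L * v) (m≡m%n+[m/n]*n u 2)) (regroup (u % 2) (u / 2) (2 ^ L) v)
  u/2<2^L : u / 2 < 2 ^ L
  u/2<2^L = m<n*o⇒m/o<n (<-≤-trans u<2^[1+L] (≤-reflexive (*-comm 2 (2 ^ L))))

s₂[2^L*v]≡s₂[v] : ∀ L v → s₂ (2 ^ L * v) ≡ s₂ v
s₂[2^L*v]≡s₂[v] L v = s₂[u+2^L*v]≡s₂[u]+s₂[v] L v (m^n>0 2 L)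

2^r∸1<2^r : ∀ r → 2 ^ r ∸ 1 < 2 ^ r
2^r∸1<2^r r = ∸-monoʳ-< (s≤s z≤n) (m^n>0 2 r)

s₂[2^r∸1]≡r : ∀ r → s₂ (2 ^ r ∸ 1) ≡ r
s₂[2^r∸1]≡r zero    = refl
s₂[2^r∸1]≡r (suc r) = begin
  s₂ (2 * 2 ^ r ∸ 1)                   ≡⟨ cong (λ p → s₂ (2 * p ∸ 1)) (suc-pred (2 ^ r) {{m^n≢0 2 r}}) ⟨
  s₂ (2 * suc (2 ^ r ∸ 1) ∸ 1)         ≡⟨ cong s₂ (double-pred (2 ^ r ∸ 1)) ⟩
  s₂ (1 + (2 ^ r ∸ 1) * 2)             ≡⟨ s₂[b+q*2]≡b+s₂[q] (2 ^ r ∸ 1) (s≤s (s≤s z≤n)) ⟩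
  1 + s₂ (2 ^ r ∸ 1)                   ≡⟨ cong suc (s₂[2^r∸1]≡r r) ⟩
  suc r                                ∎
  where
  open ≡-Reasoning
  double-pred : ∀ p → p + suc (p + 0) ≡ 1 + p * 2
  double-pred = solve-∀

mod2^-decompose : ∀ a i → a ≡ mod2^ a i + div2^ a i * 2 ^ i
mod2^-decompose a i = m≡m%n+[m/n]*n a (2 ^ i) {{m^n≢0 2 i}}

mod2^[2^r∸1]≡2^r∸1 : ∀ r → mod2^ (2 ^ r ∸ 1) (suc r) ≡ 2 ^ r ∸ 1
mod2^[2^r∸1]≡2^r∸1 r = m<n⇒m%n≡m {{m^n≢0 2 (suc r)}} (<-≤-trans (2^r∸1<2^r r) (^-monoʳ-≤ 2 (n≤1+n r)))

mod2^-weaken : ∀ {a b} i j → mod2^ a (i + j) ≡ mod2^ b (i + j) → mod2^ a i ≡ mod2^ b i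
mod2^-weaken {a} {b} i j eq = begin
  mod2^ a i                ≡⟨ reduce a ⟨
  mod2^ (mod2^ a (i + j)) i ≡⟨ cong (λ z → mod2^ z i) eq ⟩
  mod2^ (mod2^ b (i + j)) i ≡⟨ reduce b ⟩
  mod2^ b i                ∎
  where
  open ≡-Reasoning
  2^i∣2^[i+j] : 2 ^ i ∣ 2 ^ (i + j)
  2^i∣2^[i+j] = divides (2 ^ j) (trans (^-distribˡ-+-* 2 i j) (*-comm (2 ^ i) (2 ^ j)))
  reduce : ∀ c → mod2^ (mod2^ c (i + j)) i ≡ mod2^ c i
  reduce c = m∣n⇒o%n%m≡o%m (2 ^ i) (2 ^ (i + j)) c {{m^n≢0 2 i}} {{m^n≢0 2 (i + j)}} 2^i∣2^[i+j]

mod2^-*-congʳ : ∀ {a b} c i → mod2^ a i ≡ mod2^ b i → mod2^ (a * c) i ≡ mod2^ (b * c) i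
mod2^-*-congʳ {a} {b} c i eq = begin
  mod2^ (a * c) i                           ≡⟨ %-distribˡ-* a c (2 ^ i) {{m^n≢0 2 i}} ⟩
  mod2^ (mod2^ a i * mod2^ c i) i           ≡⟨ cong (λ z → mod2^ (z * mod2^ c i) i) eq ⟩
  mod2^ (mod2^ b i * mod2^ c i) i           ≡⟨ %-distribˡ-* b c (2 ^ i) {{m^n≢0 2 i}} ⟨
  mod2^ (b * c) i                           ∎
  where open ≡-Reasoning

trailing-ones-from-≡ : ∀ {a b} r l → mod2^ a (suc r + l) ≡ mod2^ b (suc r + l) →
  mod2^ b (suc r) ≡ mod2^ (2 ^ r ∸ 1) (suc r) → mod2^ a (suc r) ≡ 2 ^ r ∸ 1
trailing-ones-from-≡ r l a≡b b≡ = trans (mod2^-weaken (suc r) l a≡b) (trans b≡ (mod2^[2^r∸1]≡2^r∸1 r))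

s₂[1+2w]≡s₂[1+w]+r : ∀ r w → mod2^ w (suc r) ≡ 2 ^ r ∸ 1 → s₂ (1 + 2 * w) ≡ s₂ (1 + w) + r
s₂[1+2w]≡s₂[1+w]+r r w w≡2^r∸1 = begin
  s₂ (1 + 2 * w)                          ≡⟨ cong (λ z → s₂ (1 + z)) (*-comm 2 w) ⟩
  s₂ (1 + w * 2)                          ≡⟨ s₂[b+q*2]≡b+s₂[q] w (s≤s (s≤s z≤n)) ⟩
  1 + s₂ w                                ≡⟨ cong (λ z → 1 + s₂ z) w-digits ⟩
  1 + s₂ (2 ^ r ∸ 1 + 2 ^ r * (q * 2))    ≡⟨ cong suc (s₂[u+2^L*v]≡s₂[u]+s₂[v] r (q * 2) (2^r∸1<2^r r)) ⟩
  1 + (s₂ (2 ^ r ∸ 1) + s₂ (q * 2))       ≡⟨ cong₂ (λ s s′ → 1 + (s + s′)) (s₂[2^r∸1]≡r r) (s₂[b+q*2]≡b+s₂[q] {0} q (s≤s z≤n)) ⟩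
  1 + (r + s₂ q)                          ≡⟨ swap r (s₂ q) ⟩
  1 + s₂ q + r                            ≡⟨ cong (_+ r) s₂[1+w] ⟨
  s₂ (1 + w) + r                          ∎
  where
  open ≡-Reasoning
  q : ℕ
  q = div2^ w (suc r)
  swap : ∀ r s → 1 + (r + s) ≡ 1 + s + r
  swap = solve-∀
  w-digits : w ≡ 2 ^ r ∸ 1 + 2 ^ r * (q * 2)
  w-digits = trans (mod2^-decompose w (suc r)) (cong₂ _+_ w≡2^r∸1 (regroup q (2 ^ r)))
    where
    regroup : ∀ q p → q * (2 * p) ≡ p * (q * 2)
    regroup = solve-∀
  s₂[1+w] : s₂ (1 + w) ≡ 1 + s₂ q
  s₂[1+w] = begin
    s₂ (1 + w)                                ≡⟨ cong (λ z → s₂ (1 + z)) w-digits ⟩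
    s₂ (1 + (2 ^ r ∸ 1 + 2 ^ r * (q * 2)))    ≡⟨ cong s₂ (+-assoc 1 (2 ^ r ∸ 1) _) ⟨
    s₂ (1 + (2 ^ r ∸ 1) + 2 ^ r * (q * 2))    ≡⟨ cong (λ p → s₂ (p + 2 ^ r * (q * 2))) (m+[n∸m]≡n (m^n>0 2 r)) ⟩
    s₂ (2 ^ r + 2 ^ r * (q * 2))              ≡⟨ cong s₂ (factor (2 ^ r) (q * 2)) ⟩
    s₂ (2 ^ r * (1 + q * 2))                  ≡⟨ s₂[2^L*v]≡s₂[v] r (1 + q * 2) ⟩
    s₂ (1 + q * 2)                            ≡⟨ s₂[b+q*2]≡b+s₂[q] q (s≤s (s≤s z≤n)) ⟩
    1 + s₂ q                                  ∎
    where
    factor : ∀ p x → p + p * x ≡ p * (1 + x)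
    factor = solve-∀

[1+m]%2≢m%2 : ∀ m → suc m % 2 ≢ m % 2
[1+m]%2≢m%2 zero          ()
[1+m]%2≢m%2 (suc zero)    ()
[1+m]%2≢m%2 (suc (suc m)) eq = [1+m]%2≢m%2 m eq

[m+1+2j]%2≢m%2 : ∀ m j → (m + (1 + j * 2)) % 2 ≢ m % 2
[m+1+2j]%2≢m%2 m j eq = [1+m]%2≢m%2 m (begin
  suc m % 2                 ≡⟨ [m+kn]%n≡m%n (suc m) j 2 ⟨
  (suc m + j * 2) % 2       ≡⟨ cong (_% 2) (+-suc m (j * 2)) ⟨
  (m + (1 + j * 2)) % 2     ≡⟨ eq ⟩
  m % 2                     ∎)
  where open ≡-Reasoning

horner : (ℕ → ℕ) → ℕ → ℕ → ℕ → ℕ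
horner d P i zero    = 0
horner d P i (suc f) = d i + P * horner d P (suc i) f

horner-snoc : ∀ d P i f → horner d P i (suc f) ≡ horner d P i f + P ^ f * d (i + f)
horner-snoc d P i zero    = cong₂ _+_ (cong d (sym (+-identityʳ i))) (*-zeroʳ P)
horner-snoc d P i (suc f) = begin
  d i + P * horner d P (suc i) (suc f)                          ≡⟨ cong (λ h → d i + P * h) (horner-snoc d P (suc i) f) ⟩
  d i + P * (horner d P (suc i) f + P ^ f * d (suc i + f))      ≡⟨ cong (λ n → d i + P * (horner d P (suc i) f + P ^ f * d n)) (+-suc i f) ⟨
  d i + P * (horner d P (suc i) f + P ^ f * d (i + suc f))      ≡⟨ regroup (d i) P (horner d P (suc i) f) (P ^ f) (d (i + suc f)) ⟩
  d i + P * horner d P (suc i) f + P * P ^ f * d (i + suc f)    ∎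
  where
  open ≡-Reasoning
  regroup : ∀ a P h p x → a + P * (h + p * x) ≡ a + P * h + P * p * x
  regroup = solve-∀

horner-< : ∀ d P i f → (∀ n → i ≤ n → d n < P) → horner d P i f < P ^ f
horner-< d P i zero    d<P = s≤s z≤n
horner-< d P i (suc f) d<P = begin-strict
  d i + P * horner d P (suc i) f    <⟨ +-monoˡ-< _ (d<P i ≤-refl) ⟩
  P + P * horner d P (suc i) f      ≡⟨ cong (_+ P * horner d P (suc i) f) (*-identityʳ P) ⟨
  P * 1 + P * horner d P (suc i) f  ≡⟨ *-distribˡ-+ P 1 _ ⟨
  P * suc (horner d P (suc i) f)    ≤⟨ *-monoʳ-≤ P (horner-< d P (suc i) f (λ n i<n → d<P n (<⇒≤ i<n))) ⟩
  P * P ^ f                         ∎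
  where open ≤-Reasoning

s₂-horner-cong : ∀ d d′ L i f → (∀ n → i ≤ n → d n < 2 ^ L) → (∀ n → i ≤ n → d′ n < 2 ^ L) →
  (∀ n → i ≤ n → s₂ (d n) ≡ s₂ (d′ n)) → s₂ (horner d (2 ^ L) i f) ≡ s₂ (horner d′ (2 ^ L) i f)
s₂-horner-cong d d′ L i zero    _    _     _      = refl
s₂-horner-cong d d′ L i (suc f) d<2^L d′<2^L s₂d≡ = begin
  s₂ (d i + 2 ^ L * horner d (2 ^ L) (suc i) f)     ≡⟨ s₂[u+2^L*v]≡s₂[u]+s₂[v] L _ (d<2^L i ≤-refl) ⟩
  s₂ (d i) + s₂ (horner d (2 ^ L) (suc i) f)        ≡⟨ cong₂ _+_ (s₂d≡ i ≤-refl) (s₂-horner-cong d d′ L (suc i) f (later d<2^L) (later d′<2^L) (later s₂d≡)) ⟩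
  s₂ (d′ i) + s₂ (horner d′ (2 ^ L) (suc i) f)      ≡⟨ s₂[u+2^L*v]≡s₂[u]+s₂[v] L _ (d′<2^L i ≤-refl) ⟨
  s₂ (d′ i + 2 ^ L * horner d′ (2 ^ L) (suc i) f)   ∎
  where
  open ≡-Reasoning
  later : ∀ {Q : ℕ → Set} → (∀ n → i ≤ n → Q n) → ∀ n → suc i ≤ n → Q n
  later hyp n i<n = hyp n (<⇒≤ i<n)

open CommutativeSemiring +-*-commutativeSemiring using (+-rawMonoid; rawSemiring)
open Binomial +-*-commutativeSemiring using (binomialExpansion; binomialTerm) renaming (theorem to binomial-theorem)
open RawMonoid +-rawMonoid using () renaming (_×_ to _×ᴹ_; sum to ∑ᴹ)
open RawSemiring rawSemiring using () renaming (_^_ to _^ᴿ_)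

×≡* : ∀ n x → n ×ᴹ x ≡ n * x
×≡* zero    x = refl
×≡* (suc n) x = cong (x +_) (×≡* n x)

^≡^ : ∀ x n → x ^ᴿ n ≡ x ^ n
^≡^ x zero    = refl
^≡^ x (suc n) = cong (x *_) (^≡^ x n)

[x*y]^n≡x^n*y^n : ∀ x y n → (x * y) ^ n ≡ x ^ n * y ^ n
[x*y]^n≡x^n*y^n x y zero    = refl
[x*y]^n≡x^n*y^n x y (suc n) = trans (cong (x * y *_) ([x*y]^n≡x^n*y^n x y n)) (interchange x y (x ^ n) (y ^ n))
  where
  interchange : ∀ x y x′ y′ → x * y * (x′ * y′) ≡ x * x′ * (y * y′)
  interchange = solve-∀

sum≡horner : ∀ d P i f c (g : Fin f → ℕ) → (∀ l → g l ≡ c * (d (i + toℕ l) * P ^ toℕ l)) →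
  ∑ᴹ g ≡ c * horner d P i f
sum≡horner d P i zero    c g g≡ = sym (*-zeroʳ c)
sum≡horner d P i (suc f) c g g≡ = begin
  g fzero + ∑ᴹ (λ l → g (fsuc l))   ≡⟨ cong₂ _+_ (g≡ fzero) (sum≡horner d P (suc i) f (c * P) (λ l → g (fsuc l)) g∘suc≡) ⟩
  c * (d (i + 0) * 1) + c * P * horner d P (suc i) f        ≡⟨ cong (λ n → c * (d n * 1) + c * P * horner d P (suc i) f) (+-identityʳ i) ⟩
  c * (d i * 1) + c * P * horner d P (suc i) f              ≡⟨ factor c (d i) P (horner d P (suc i) f) ⟩
  c * (d i + P * horner d P (suc i) f)                      ∎
  where
  open ≡-Reasoning
  factor : ∀ c a P h → c * (a * 1) + c * P * h ≡ c * (a + P * h)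
  factor = solve-∀
  shift : ∀ c a P p → c * (a * (P * p)) ≡ c * P * (a * p)
  shift = solve-∀
  g∘suc≡ : ∀ l → g (fsuc l) ≡ c * P * (d (suc i + toℕ l) * P ^ toℕ l)
  g∘suc≡ l = trans (g≡ (fsuc l)) (trans (cong (λ n → c * (d n * (P * P ^ toℕ l))) (+-suc i (toℕ l)))
    (shift c (d (suc i + toℕ l)) P (P ^ toℕ l)))

binomial-horner : ∀ n b P a → (b * P + a) ^ n ≡ horner (λ i → (n C i) * b ^ i * a ^ (n ∸ i)) P 0 (suc n)
binomial-horner n b P a = begin
  (b * P + a) ^ n                                             ≡⟨ ^≡^ (b * P + a) n ⟨
  (b * P + a) ^ᴿ n                   ≡⟨ binomial-theorem n (b * P) a ⟩
  binomialExpansion (b * P) a n                               ≡⟨ sum≡horner _ P 0 (suc n) 1 _ term≡ ⟩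
  1 * horner (λ i → (n C i) * b ^ i * a ^ (n ∸ i)) P 0 (suc n)  ≡⟨ *-identityˡ _ ⟩
  horner (λ i → (n C i) * b ^ i * a ^ (n ∸ i)) P 0 (suc n)      ∎
  where
  open ≡-Reasoning
  regroup : ∀ C B p A → C * (B * p * A) ≡ 1 * (C * B * A * p)
  regroup = solve-∀
  term≡ : ∀ l → binomialTerm (b * P) a n l ≡ 1 * ((n C toℕ l) * b ^ toℕ l * a ^ (n ∸ toℕ l) * P ^ toℕ l)
  term≡ l = begin
    (n C toℕ l) ×ᴹ ((b * P) ^ᴿ toℕ l * a ^ᴿ (n ∸ toℕ l))
      ≡⟨ ×≡* (n C toℕ l) _ ⟩
    (n C toℕ l) * ((b * P) ^ᴿ toℕ l * a ^ᴿ (n ∸ toℕ l))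
      ≡⟨ cong₂ (λ u v → (n C toℕ l) * (u * v)) (trans (^≡^ (b * P) (toℕ l)) ([x*y]^n≡x^n*y^n b P (toℕ l))) (^≡^ a (n ∸ toℕ l)) ⟩
    (n C toℕ l) * (b ^ toℕ l * P ^ toℕ l * a ^ (n ∸ toℕ l))
      ≡⟨ regroup (n C toℕ l) (b ^ toℕ l) (P ^ toℕ l) (a ^ (n ∸ toℕ l)) ⟩
    1 * ((n C toℕ l) * b ^ toℕ l * a ^ (n ∸ toℕ l) * P ^ toℕ l)   ∎

2^ν-aux∣ : ∀ f n → 2 ^ ν-aux f n ∣ n
2^ν-aux∣ zero    n = 1∣ n
2^ν-aux∣ (suc f) zero = 1∣ 0
2^ν-aux∣ (suc f) n@(suc _) with n % 2 in n%2≡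
... | zero  = subst (2 * 2 ^ ν-aux f (n / 2) ∣_) 2*[n/2]≡n (*-monoʳ-∣ 2 (2^ν-aux∣ f (n / 2)))
  where
  2*[n/2]≡n : 2 * (n / 2) ≡ n
  2*[n/2]≡n = trans (*-comm 2 (n / 2)) (trans (cong (_+ n / 2 * 2) (sym n%2≡)) (sym (m≡m%n+[m/n]*n n 2)))
... | suc _ = 1∣ n

oddPart*2^ν≡id : ∀ k → oddPart k * 2 ^ ν k ≡ k
oddPart*2^ν≡id k = m/n*n≡m {{m^n≢0 2 (ν k)}} (2^ν-aux∣ k k)

oddPart≤id : ∀ k → oddPart k ≤ k
oddPart≤id k = m/n≤m k (2 ^ ν k) {{m^n≢0 2 (ν k)}}

n<2^n : ∀ n → n < 2 ^ n
n<2^n zero    = s≤s z≤n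
n<2^n (suc n) = +-mono-≤ (m^n>0 2 n) (≤-trans (n<2^n n) (m≤m+n (2 ^ n) 0))

nCk≤2^n : ∀ n i → n C i ≤ 2 ^ n
nCk≤2^n n       zero    = m^n>0 2 n
nCk≤2^n zero    (suc i) = z≤n
nCk≤2^n (suc n) (suc i) = begin
  suc n C suc i          ≡⟨ nCk+nC[k+1]≡[n+1]C[k+1] n i ⟨
  n C i + n C suc i      ≤⟨ +-mono-≤ (nCk≤2^n n i) (≤-trans (nCk≤2^n n (suc i)) (m≤m+n (2 ^ n) 0)) ⟩
  2 ^ n + (2 ^ n + 0)    ∎
  where open ≤-Reasoning

-- Bounds every product of binomial coefficient, power of c and power of b met as a digit below.
coefficientBound : ℕ → ℕ → ℕ
coefficientBound k y = k * (2 ^ k * (3 ^ k * (2 * y) ^ k))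

threshold : ℕ → ℕ → ℕ
threshold k y = suc (coefficientBound k y + 2 * pred k + ν k)

module PowerExpansion (j c y N : ℕ) .{{_ : NonZero j}} .{{_ : NonZero y}}
                      (c≤3 : c ≤ 3) (N₀≤N : threshold (suc j) y ≤ N) where

  k v o U K X a P Q : ℕ
  k = suc j
  v = ν k
  o = oddPart k
  U = coefficientBound k y
  K = k * N ∸ v
  X = 2 ^ N
  a = X + c
  P = 2 ^ K
  Q = 2 ^ (N * k)

  kN-room : suc (U + (N + 2) * j) + v ≤ k * N
  kN-room = begin
    suc (U + (N + 2) * j) + v  ≡⟨ regroup U N j v ⟩
    threshold k y + j * N      ≤⟨ +-monoˡ-≤ (j * N) N₀≤N ⟩
    k * N                      ∎
    where
    open ≤-Reasoning
    regroup : ∀ U N j v → suc (U + (N + 2) * j) + v ≡ suc (U + 2 * j + v) + j * N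
    regroup = solve-∀

  room : suc (U + (N + 2) * j) ≤ K
  room = m+n≤o⇒m≤o∸n _ kN-room

  K+v≡kN : K + v ≡ k * N
  K+v≡kN = m∸n+n≡m (≤-trans (m≤n+m v _) kN-room)

  U<N : U < N
  U<N = ≤-trans (s≤s (≤-trans (m≤m+n U (2 * j)) (m≤m+n _ v))) N₀≤N

  N+2≤K : N + 2 ≤ K
  N+2≤K = ≤-trans (m≤m*n (N + 2) j) (≤-trans (m≤n+m _ U) (<⇒≤ room))

  a^i≤2^[[N+2]*i] : ∀ i → a ^ i ≤ 2 ^ ((N + 2) * i)
  a^i≤2^[[N+2]*i] i = ≤-trans (^-monoˡ-≤ i a≤2^[N+2]) (≤-reflexive (^-*-assoc 2 (N + 2) i))
    where
    a≤2^[N+2] : a ≤ 2 ^ (N + 2)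
    a≤2^[N+2] = begin
      X + c      ≤⟨ +-monoʳ-≤ X (≤-trans c≤3 (*-monoʳ-≤ 3 (m^n>0 2 N))) ⟩
      X + 3 * X  ≡⟨ fold X ⟩
      X * 2 ^ 2  ≡⟨ ^-distribˡ-+-* 2 N 2 ⟨
      2 ^ (N + 2) ∎
      where
      open ≤-Reasoning
      fold : ∀ X → X + 3 * X ≡ X * 4
      fold = solve-∀

  ≤U : ∀ {α β γ δ} → α ≤ k → β ≤ 2 ^ k → γ ≤ 3 ^ k → δ ≤ (2 * y) ^ k → α * (β * (γ * δ)) ≤ U
  ≤U α≤ β≤ γ≤ δ≤ = *-mono-≤ α≤ (*-mono-≤ β≤ (*-mono-≤ γ≤ δ≤))

  c^i≤3^k : ∀ i → i ≤ k → c ^ i ≤ 3 ^ k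
  c^i≤3^k i i≤k = ≤-trans (^-monoˡ-≤ i c≤3) (^-monoʳ-≤ 3 i≤k)

  b^i≤[2y]^k : ∀ {b} i → b ≤ 2 * y → i ≤ k → b ^ i ≤ (2 * y) ^ k
  b^i≤[2y]^k i b≤2y i≤k = ≤-trans (^-monoˡ-≤ i b≤2y) (^-monoʳ-≤ (2 * y) {{m*n≢0 2 y}} i≤k)

  b≤[2y]^k : ∀ {b} → b ≤ 2 * y → b ≤ (2 * y) ^ k
  b≤[2y]^k {b} b≤2y = ≤-trans (≤-reflexive (sym (*-identityʳ b))) (b^i≤[2y]^k 1 b≤2y (s≤s z≤n))

  ≤U⇒<2^[U+e] : ∀ {x z} e → x ≤ U → z ≤ 2 ^ e → x * z < 2 ^ (U + e)
  ≤U⇒<2^[U+e] {x} {z} e x≤U z≤2^e = begin-strict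
    x * z          ≤⟨ *-mono-≤ x≤U z≤2^e ⟩
    U * 2 ^ e      <⟨ *-monoˡ-< (2 ^ e) {{m^n≢0 2 e}} (n<2^n U) ⟩
    2 ^ U * 2 ^ e  ≡⟨ ^-distribˡ-+-* 2 U e ⟨
    2 ^ (U + e)    ∎
    where open ≤-Reasoning

  rDigit eDigit : ℕ → ℕ
  rDigit i = (k C i) * 1 ^ i * c ^ (k ∸ i)
  eDigit i = (j C i) * 1 ^ i * c ^ (j ∸ i)

  R E : ℕ
  R = horner rDigit X 0 k
  E = horner eDigit X 1 j

  zDigit : ℕ → ℕ → ℕ
  zDigit b i = (k C i) * b ^ i * a ^ (k ∸ i)

  H w Z L : ℕ → ℕ
  H b = horner (zDigit b) P 2 j
  w b = o * b * c ^ j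
  Z b = (b * P + X + c) ^ k
  L b = a ^ k + P * (k * b * a ^ j)

  a^k≡R+Q : a ^ k ≡ R + Q
  a^k≡R+Q = begin
    (X + c) ^ k                  ≡⟨ cong (λ z → (z + c) ^ k) (*-identityˡ X) ⟨
    (1 * X + c) ^ k              ≡⟨ binomial-horner k 1 X c ⟩
    horner rDigit X 0 (suc k)    ≡⟨ horner-snoc rDigit X 0 k ⟩
    R + X ^ k * rDigit k         ≡⟨ cong₂ (λ p d → R + p * d) (^-*-assoc 2 N k) rDigit[k]≡1 ⟩
    R + Q * 1                    ≡⟨ cong (R +_) (*-identityʳ Q) ⟩
    R + Q                        ∎
    where
    open ≡-Reasoning
    rDigit[k]≡1 : rDigit k ≡ 1
    rDigit[k]≡1 = trans (cong₂ (λ C e → C * 1 ^ k * c ^ e) (nCn≡1 k) (n∸n≡0 k)) (cong (λ p → 1 * p * 1) (^-zeroˡ k))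

  a^j≡c^j+X*E : a ^ j ≡ c ^ j + X * E
  a^j≡c^j+X*E = begin
    (X + c) ^ j                  ≡⟨ cong (λ z → (z + c) ^ j) (*-identityˡ X) ⟨
    (1 * X + c) ^ j              ≡⟨ binomial-horner j 1 X c ⟩
    1 * c ^ j + X * E            ≡⟨ cong (_+ X * E) (*-identityˡ (c ^ j)) ⟩
    c ^ j + X * E                ∎
    where open ≡-Reasoning

  Z≡L+2^[K+K]*H : ∀ b → Z b ≡ L b + 2 ^ (K + K) * H b
  Z≡L+2^[K+K]*H b = begin
    (b * P + X + c) ^ k                              ≡⟨ cong (_^ k) (+-assoc (b * P) X c) ⟩
    (b * P + a) ^ k                                  ≡⟨ binomial-horner k b P a ⟩
    zDigit b 0 + P * (zDigit b 1 + P * H b)          ≡⟨ cong₂ (λ z₀ z₁ → z₀ + P * (z₁ + P * H b)) (*-identityˡ (a ^ k)) zDigit[1] ⟩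
    a ^ k + P * (k * b * a ^ j + P * H b)            ≡⟨ regroup (a ^ k) P (k * b * a ^ j) (H b) ⟩
    L b + P * P * H b                                ≡⟨ cong (λ p → L b + p * H b) (^-distribˡ-+-* 2 K K) ⟨
    L b + 2 ^ (K + K) * H b                          ∎
    where
    open ≡-Reasoning
    regroup : ∀ A P B H → A + P * (B + P * H) ≡ A + P * B + P * P * H
    regroup = solve-∀
    zDigit[1] : zDigit b 1 ≡ k * b * a ^ j
    zDigit[1] = cong₂ (λ C p → C * p * a ^ j) (nC1≡n k) (*-identityʳ b)

  L≡R+Q*[1+w+X*oBE] : ∀ b → L b ≡ R + Q * ((1 + w b) + X * (o * b * E))
  L≡R+Q*[1+w+X*oBE] b = begin
    a ^ k + P * (k * b * a ^ j)                       ≡⟨ cong₂ (λ A B → A + P * (k * b * B)) a^k≡R+Q a^j≡c^j+X*E ⟩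
    R + Q + P * (k * b * (c ^ j + X * E))             ≡⟨ regroup R Q P k b (c ^ j + X * E) ⟩
    R + Q + P * k * (b * (c ^ j + X * E))             ≡⟨ cong (λ z → R + Q + z * (b * (c ^ j + X * E))) P*k≡o*Q ⟩
    R + Q + o * Q * (b * (c ^ j + X * E))             ≡⟨ expand R Q o b (c ^ j) X E ⟩
    R + Q * ((1 + o * b * c ^ j) + X * (o * b * E))   ∎
    where
    open ≡-Reasoning
    regroup : ∀ R Q P k b A → R + Q + P * (k * b * A) ≡ R + Q + P * k * (b * A)
    regroup = solve-∀
    expand : ∀ R Q o b C X E → R + Q + o * Q * (b * (C + X * E)) ≡ R + Q * ((1 + o * b * C) + X * (o * b * E))
    expand = solve-∀
    P*k≡o*Q : P * k ≡ o * Q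
    P*k≡o*Q = begin
      P * k                 ≡⟨ cong (P *_) (oddPart*2^ν≡id k) ⟨
      P * (o * 2 ^ v)       ≡⟨ swap P o (2 ^ v) ⟩
      o * (P * 2 ^ v)       ≡⟨ cong (o *_) (^-distribˡ-+-* 2 K v) ⟨
      o * 2 ^ (K + v)       ≡⟨ cong (λ e → o * 2 ^ e) (trans K+v≡kN (*-comm k N)) ⟩
      o * Q                 ∎
      where
      swap : ∀ P o V → P * (o * V) ≡ o * (P * V)
      swap = solve-∀

  1+x<X : ∀ {x} → x ≤ U → 1 + x < X
  1+x<X x≤U = ≤-<-trans (≤-trans (s≤s x≤U) U<N) (n<2^n N)

  R<Q : R < Q
  R<Q = subst (R <_) (^-*-assoc 2 N k) (horner-< rDigit X 0 k (λ i _ → rDigit<X i))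
    where
    regroup : ∀ C p → C * 1 * p ≡ 1 * (C * (p * 1))
    regroup = solve-∀
    rDigit<X : ∀ i → rDigit i < X
    rDigit<X i = ≤-<-trans (n≤1+n _) (1+x<X (≤-trans (≤-reflexive rDigit≡)
      (≤U (s≤s z≤n) (nCk≤2^n k i) (c^i≤3^k (k ∸ i) (m∸n≤m k i)) (m^n>0 (2 * y) {{m*n≢0 2 y}} k))))
      where
      rDigit≡ : rDigit i ≡ 1 * ((k C i) * (c ^ (k ∸ i) * 1))
      rDigit≡ = trans (cong (λ p → (k C i) * p * c ^ (k ∸ i)) (^-zeroˡ i)) (regroup (k C i) (c ^ (k ∸ i)))

  1+w<X : ∀ {b} → b ≤ 2 * y → 1 + w b < X
  1+w<X {b} b≤2y = 1+x<X (≤-trans (≤-reflexive (regroup o b (c ^ j)))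
    (≤U (oddPart≤id k) (m^n>0 2 k) (c^i≤3^k j (n≤1+n j)) (b≤[2y]^k b≤2y)))
    where
    regroup : ∀ o b p → o * b * p ≡ o * (1 * (p * b))
    regroup = solve-∀

  zDigit<P : ∀ {b} → b ≤ 2 * y → ∀ i → 2 ≤ i → zDigit b i < P
  zDigit<P {b} b≤2y i 2≤i with i ≤? k
  ... | no i≰k = subst (λ C → C * b ^ i * a ^ (k ∸ i) < P) (sym (k>n⇒nCk≡0 (≰⇒> i≰k))) (m^n>0 2 K)
  ... | yes i≤k = begin-strict
    (k C i) * b ^ i * a ^ (k ∸ i)  <⟨ ≤U⇒<2^[U+e] ((N + 2) * j) Cb≤U a^[k∸i]≤ ⟩
    2 ^ (U + (N + 2) * j)          ≤⟨ ^-monoʳ-≤ 2 (<⇒≤ room) ⟩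
    P                              ∎
    where
    open ≤-Reasoning
    regroup : ∀ C B → C * B ≡ 1 * (C * (1 * B))
    regroup = solve-∀
    Cb≤U : (k C i) * b ^ i ≤ U
    Cb≤U = ≤-trans (≤-reflexive (regroup (k C i) (b ^ i)))
      (≤U (s≤s z≤n) (nCk≤2^n k i) (m^n>0 3 k) (b^i≤[2y]^k i b≤2y i≤k))
    a^[k∸i]≤ : a ^ (k ∸ i) ≤ 2 ^ ((N + 2) * j)
    a^[k∸i]≤ = ≤-trans (a^i≤2^[[N+2]*i] (k ∸ i))
      (^-monoʳ-≤ 2 (*-monoʳ-≤ (N + 2) (∸-monoʳ-≤ k (≤-trans (s≤s z≤n) 2≤i))))

  L<2^[K+K] : ∀ {b} → b ≤ 2 * y → L b < 2 ^ (K + K)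
  L<2^[K+K] {b} b≤2y = begin-strict
    a ^ k + P * (k * b * a ^ j)   <⟨ +-mono-≤-< a^k≤ P*kba^j< ⟩
    2 ^ (K + D) + 2 ^ (K + D)     ≡⟨ cong (2 ^ (K + D) +_) (+-identityʳ _) ⟨
    2 ^ suc (K + D)               ≤⟨ ^-monoʳ-≤ 2 (≤-trans (≤-reflexive (sym (+-suc K D))) (+-monoʳ-≤ K room)) ⟩
    2 ^ (K + K)                   ∎
    where
    open ≤-Reasoning
    D : ℕ
    D = U + (N + 2) * j
    a^k≤ : a ^ k ≤ 2 ^ (K + D)
    a^k≤ = ≤-trans (a^i≤2^[[N+2]*i] k) (^-monoʳ-≤ 2 (begin
      (N + 2) * k                ≡⟨ *-suc (N + 2) j ⟩
      N + 2 + (N + 2) * j        ≤⟨ +-mono-≤ N+2≤K (m≤n+m _ U) ⟩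
      K + D                      ∎))
    regroup : ∀ k b → k * b ≡ k * (1 * (1 * b))
    regroup = solve-∀
    kb≤U : k * b ≤ U
    kb≤U = ≤-trans (≤-reflexive (regroup k b)) (≤U ≤-refl (m^n>0 2 k) (m^n>0 3 k) (b≤[2y]^k b≤2y))
    P*kba^j< : P * (k * b * a ^ j) < 2 ^ (K + D)
    P*kba^j< = begin-strict
      P * (k * b * a ^ j)   <⟨ *-monoʳ-< P {{m^n≢0 2 K}} (≤U⇒<2^[U+e] ((N + 2) * j) kb≤U (a^i≤2^[[N+2]*i] j)) ⟩
      P * 2 ^ D             ≡⟨ ^-distribˡ-+-* 2 K D ⟨
      2 ^ (K + D)           ∎

  s₂-Z : ∀ b → b ≤ 2 * y → s₂ (Z b) ≡ s₂ R + (s₂ (1 + w b) + s₂ (o * b * E)) + s₂ (H b)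
  s₂-Z b b≤2y = begin
    s₂ (Z b)                                            ≡⟨ cong s₂ (Z≡L+2^[K+K]*H b) ⟩
    s₂ (L b + 2 ^ (K + K) * H b)                        ≡⟨ s₂[u+2^L*v]≡s₂[u]+s₂[v] (K + K) (H b) (L<2^[K+K] b≤2y) ⟩
    s₂ (L b) + s₂ (H b)                                 ≡⟨ cong (λ s → s + s₂ (H b)) s₂-L ⟩
    s₂ R + (s₂ (1 + w b) + s₂ (o * b * E)) + s₂ (H b)   ∎
    where
    open ≡-Reasoning
    s₂-L : s₂ (L b) ≡ s₂ R + (s₂ (1 + w b) + s₂ (o * b * E))
    s₂-L = begin
      s₂ (L b)                                        ≡⟨ cong s₂ (L≡R+Q*[1+w+X*oBE] b) ⟩
      s₂ (R + Q * ((1 + w b) + X * (o * b * E)))      ≡⟨ s₂[u+2^L*v]≡s₂[u]+s₂[v] (N * k) _ R<Q ⟩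
      s₂ R + s₂ ((1 + w b) + X * (o * b * E))         ≡⟨ cong (s₂ R +_) (s₂[u+2^L*v]≡s₂[u]+s₂[v] N (o * b * E) (1+w<X b≤2y)) ⟩
      s₂ R + (s₂ (1 + w b) + s₂ (o * b * E))          ∎

  s₂-Z[2y]+s₂[1+w] : s₂ (Z (2 * y)) + s₂ (1 + w y) ≡ s₂ (Z y) + s₂ (1 + 2 * w y)
  s₂-Z[2y]+s₂[1+w] = begin
    s₂ (Z (2 * y)) + s₂ (1 + w y)
      ≡⟨ cong (_+ s₂ (1 + w y)) (s₂-Z (2 * y) ≤-refl) ⟩
    s₂ R + (s₂ (1 + w (2 * y)) + s₂ (o * (2 * y) * E)) + s₂ (H (2 * y)) + s₂ (1 + w y)
      ≡⟨ cong₂ (λ s h → s₂ R + s + h + s₂ (1 + w y)) (cong₂ _+_ (cong (λ z → s₂ (1 + z)) w[2y]≡2*w[y]) s₂-oE) s₂-H ⟩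
    s₂ R + (s₂ (1 + 2 * w y) + s₂ (o * y * E)) + s₂ (H y) + s₂ (1 + w y)
      ≡⟨ swap (s₂ R) (s₂ (1 + 2 * w y)) (s₂ (o * y * E)) (s₂ (H y)) (s₂ (1 + w y)) ⟩
    s₂ R + (s₂ (1 + w y) + s₂ (o * y * E)) + s₂ (H y) + s₂ (1 + 2 * w y)
      ≡⟨ cong (_+ s₂ (1 + 2 * w y)) (s₂-Z y (m≤n*m y 2)) ⟨
    s₂ (Z y) + s₂ (1 + 2 * w y)
      ∎
    where
    open ≡-Reasoning
    swap : ∀ r d e h d′ → r + (d + e) + h + d′ ≡ r + (d′ + e) + h + d
    swap = solve-∀
    w[2y]≡2*w[y] : w (2 * y) ≡ 2 * w y
    w[2y]≡2*w[y] = regroup o y (c ^ j)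
      where
      regroup : ∀ o y p → o * (2 * y) * p ≡ 2 * (o * y * p)
      regroup = solve-∀
    s₂-oE : s₂ (o * (2 * y) * E) ≡ s₂ (o * y * E)
    s₂-oE = trans (cong s₂ (regroup o y E)) (s₂[2^L*v]≡s₂[v] 1 (o * y * E))
      where
      regroup : ∀ o y E → o * (2 * y) * E ≡ 2 * (o * y * E)
      regroup = solve-∀
    zDigit[2y]≡2^i*zDigit[y] : ∀ i → zDigit (2 * y) i ≡ 2 ^ i * zDigit y i
    zDigit[2y]≡2^i*zDigit[y] i = trans (cong (λ p → (k C i) * p * a ^ (k ∸ i)) ([x*y]^n≡x^n*y^n 2 y i))
      (regroup (k C i) (2 ^ i) (y ^ i) (a ^ (k ∸ i)))
      where
      regroup : ∀ C t p q → C * (t * p) * q ≡ t * (C * p * q)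
      regroup = solve-∀
    s₂-H : s₂ (H (2 * y)) ≡ s₂ (H y)
    s₂-H = s₂-horner-cong (zDigit (2 * y)) (zDigit y) K 2 j (zDigit<P ≤-refl) (zDigit<P (m≤n*m y 2))
      (λ i _ → trans (cong s₂ (zDigit[2y]≡2^i*zDigit[y] i)) (s₂[2^L*v]≡s₂[v] i (zDigit y i)))

  s₂-Z[2y]≡s₂-Z[y]+r : ∀ r → mod2^ (w y) (suc r) ≡ 2 ^ r ∸ 1 → s₂ (Z (2 * y)) ≡ s₂ (Z y) + r
  s₂-Z[2y]≡s₂-Z[y]+r r w≡2^r∸1 = +-cancelʳ-≡ (s₂ (1 + w y)) _ _ (begin
    s₂ (Z (2 * y)) + s₂ (1 + w y)        ≡⟨ s₂-Z[2y]+s₂[1+w] ⟩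
    s₂ (Z y) + s₂ (1 + 2 * w y)          ≡⟨ cong (s₂ (Z y) +_) (s₂[1+2w]≡s₂[1+w]+r r (w y) w≡2^r∸1) ⟩
    s₂ (Z y) + (s₂ (1 + w y) + r)        ≡⟨ swap (s₂ (Z y)) (s₂ (1 + w y)) r ⟩
    s₂ (Z y) + r + s₂ (1 + w y)          ∎)
    where
    open ≡-Reasoning
    swap : ∀ z s r → z + (s + r) ≡ z + r + s
    swap = solve-∀

  t-Z[y*2^[K+1]] : ∀ r → mod2^ (w y) (suc r) ≡ 2 ^ r ∸ 1 → t ((y * 2 ^ (K + 1) + X + c) ^ k) ≡ (s₂ (Z y) + r) % 2
  t-Z[y*2^[K+1]] r w≡2^r∸1 = cong (_% 2) (begin
    s₂ ((y * 2 ^ (K + 1) + X + c) ^ k)    ≡⟨ cong (λ z → s₂ ((z + X + c) ^ k)) y*2^[K+1]≡2y*P ⟩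
    s₂ (Z (2 * y))                        ≡⟨ s₂-Z[2y]≡s₂-Z[y]+r r w≡2^r∸1 ⟩
    s₂ (Z y) + r                          ∎)
    where
    open ≡-Reasoning
    regroup : ∀ y p → y * (p * 2) ≡ 2 * y * p
    regroup = solve-∀
    y*2^[K+1]≡2y*P : y * 2 ^ (K + 1) ≡ 2 * y * P
    y*2^[K+1]≡2y*P = trans (cong (y *_) (^-distribˡ-+-* 2 K 1)) (regroup y P)

lemma2p3 : (k m n x y : ℕ) → 2 ≤ k → 1 ≤ m → 1 ≤ n → 1 ≤ x →
    mod2^ x (2 * m) ≡ mod2^ (2 ^ (2 * m ∸ 1) ∸ 1) (2 * m) →
    mod2^ (3 ^ (k ∸ 1) * x) (2 * n + 1) ≡ mod2^ (2 ^ (2 * n) ∸ 1) (2 * n + 1) →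
    1 ≤ y →
    mod2^ (oddPart k * y) (2 * m + 2 * n + 1) ≡ mod2^ x (2 * m + 2 * n + 1) →
    ((z : ℕ) → 1 ≤ z → z < y →
      mod2^ (oddPart k * z) (2 * m + 2 * n + 1) ≢ mod2^ x (2 * m + 2 * n + 1)) →
    ∃[ N₀ ] ((N : ℕ) → N₀ ≤ N →
      (t ((y * 2 ^ (k * N ∸ ν k) + 2 ^ N + 1) ^ k)
        ≢ t ((y * 2 ^ (k * N ∸ ν k + 1) + 2 ^ N + 1) ^ k))
      × (t ((y * 2 ^ (k * N ∸ ν k) + 2 ^ N + 3) ^ k)
        ≡ t ((y * 2 ^ (k * N ∸ ν k + 1) + 2 ^ N + 3) ^ k)))
lemma2p3 (suc j@(suc _)) m@(suc m′) n x y@(suc _) (s≤s (s≤s _)) _ _ _ x≡ 3^jx≡ _ oy≡x _ =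
  threshold (suc j) y , λ N N₀≤N →
    let module E₁ = PowerExpansion j 1 y N (s≤s z≤n) N₀≤N
        module E₃ = PowerExpansion j 3 y N (s≤s (s≤s (s≤s z≤n))) N₀≤N
    in (λ t≡ → [m+1+2j]%2≢m%2 (s₂ (E₁.Z y)) m′ (begin
         (s₂ (E₁.Z y) + (1 + m′ * 2)) % 2               ≡⟨ cong (λ e → (s₂ (E₁.Z y) + e) % 2) (2m∸1≡1+m′*2 m′) ⟨
         (s₂ (E₁.Z y) + (2 * m ∸ 1)) % 2                ≡⟨ E₁.t-Z[y*2^[K+1]] (2 * m ∸ 1) w≡[c=1] ⟨
         t ((y * 2 ^ (E₁.K + 1) + E₁.X + 1) ^ suc j)    ≡⟨ t≡ ⟨
         t (E₁.Z y)                                     ∎))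
     , (begin
         t (E₃.Z y)                                     ≡⟨ [m+kn]%n≡m%n (s₂ (E₃.Z y)) n 2 ⟨
         (s₂ (E₃.Z y) + n * 2) % 2                      ≡⟨ cong (λ e → (s₂ (E₃.Z y) + e) % 2) (*-comm n 2) ⟩
         (s₂ (E₃.Z y) + 2 * n) % 2                      ≡⟨ E₃.t-Z[y*2^[K+1]] (2 * n) w≡[c=3] ⟨
         t ((y * 2 ^ (E₃.K + 1) + E₃.X + 3) ^ suc j)    ∎)
  where
  open ≡-Reasoning
  o : ℕ
  o = oddPart (suc j)
  2m∸1≡1+m′*2 : ∀ m′ → m′ + suc (m′ + 0) ≡ 1 + m′ * 2
  2m∸1≡1+m′*2 = solve-∀
  oy≡x[mod2^_] : ∀ {i} → 2 * m + 2 * n + 1 ≡ i → mod2^ (o * y) i ≡ mod2^ x i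
  oy≡x[mod2^_] eq = subst (λ e → mod2^ (o * y) e ≡ mod2^ x e) eq oy≡x
  w≡[c=1] : mod2^ (o * y * 1 ^ j) (2 * m) ≡ 2 ^ (2 * m ∸ 1) ∸ 1
  w≡[c=1] = trailing-ones-from-≡ (2 * m ∸ 1) (2 * n + 1)
    (trans (cong (λ z → mod2^ z (2 * m + (2 * n + 1))) (trans (cong (o * y *_) (^-zeroˡ j)) (*-identityʳ (o * y))))
           oy≡x[mod2^ +-assoc (2 * m) (2 * n) 1 ])
    x≡
  w≡[c=3] : mod2^ (o * y * 3 ^ j) (suc (2 * n)) ≡ 2 ^ (2 * n) ∸ 1
  w≡[c=3] = trailing-ones-from-≡ (2 * n) (2 * m)
    (trans (mod2^-*-congʳ (3 ^ j) (suc (2 * n) + 2 * m) oy≡x[mod2^ rotate (2 * m) (2 * n) ])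
           (cong (λ z → mod2^ z (suc (2 * n) + 2 * m)) (*-comm x (3 ^ j))))
    (subst (λ e → mod2^ (3 ^ j * x) e ≡ mod2^ (2 ^ (2 * n) ∸ 1) e) (+-comm (2 * n) 1) 3^jx≡)
    where
    rotate : ∀ a b → a + b + 1 ≡ suc b + a
    rotate = solve-∀
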